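{- Let $m, q \geq 1$ be integers and consider the Box Game with resets $rBox(m,q)$. For every integer $k \geq 1$, BoxBreaker has a strategy which ensures that, at any point during the first $k$ rounds of the game, every box has weight at most $q(1 + \log(m+k))$.
   Context: The Box Game with resets $rBox(m,q)$ is played by BoxMaker and BoxBreaker on pairwise disjoint sets (boxes) $A_1, \ldots, A_m$. In each round, BoxMaker claims $q$ elements of $\bigcup_{i=1}^m A_i$, and then BoxBreaker resets one box $A_i$ of his choice, i.e., deletes all of BoxMaker's elements from $A_i$ (the box stays in the game and BoxMaker may claim its elements again). At any moment, the weight of box $A_i$ is the number of elements of $A_i$ claimed by BoxMaker and not yet deleted by BoxBreaker. $\log$ denotes the natural logarithm. -}

module Defs where

open import Data.Nat using (ℕ; zero; suc; _+_; _*_; _∸_; _^_; _≤_; _⊓_; _!)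
open import Data.Product using (_×_)
open import Relation.Binary.PropositionalEquality using (_≡_)
open import Data.Fin using (Fin; zero; suc; _≟_)
open import Data.List using (List; []; _∷_)
open import Relation.Nullary using (yes; no)

-- Real-number inequality  w ≤ q (1 + log N)  expressed over ℕ.
--
-- For naturals w, q ≥ 1, N ≥ 1 (log = natural logarithm):
--   w ≤ q(1 + log N)  ⇔  w - q ≤ q log N  ⇔  e^(w - q) ≤ N^q.
-- When w ≤ q both sides hold trivially (e^(w-q) ≤ 1 ≤ N^q), so we may use
-- truncated subtraction d = w ∸ q.
-- e^d = sup_n Σ_{j ≤ n} d^j / j!  (the defining series, nonnegative terms), so
--   e^d ≤ M  ⇔  ∀ n, Σ_{j ≤ n} d^j / j! ≤ M  ⇔  ∀ n, n! Σ_{j≤n} d^j/j! ≤ M · n!.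
-- expPartial d n = n! · Σ_{j ≤ n} d^j / j!   (a natural number)
expPartial : ℕ → ℕ → ℕ
expPartial d zero    = 1
expPartial d (suc n) = suc n * expPartial d n + d ^ suc n

-- ExpLe d M  :⇔  e^d ≤ M
ExpLe : ℕ → ℕ → Set
ExpLe d M = ∀ n → expPartial d n ≤ M * (n !)

-- WeightBound q N w  :⇔  w ≤ q (1 + log N)
WeightBound : ℕ → ℕ → ℕ → Set
WeightBound q N w = ExpLe (w ∸ q) (N ^ q)

-- Elements inside one box are interchangeable, so a position is the
-- vector of weights (number of BoxMaker's undeleted elements in each box).

Weights : ℕ → Set
Weights m = Fin m → ℕ

sumF : ∀ {m} → (Fin m → ℕ) → ℕ
sumF {zero}  f = 0
sumF {suc m} f = f zero + sumF (λ i → f (suc i))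

MakerMove : ∀ {m} → (size : Fin m → ℕ) → (q : ℕ) → Weights m → Weights m → Set
MakerMove size q w w' =
  (∀ i → w i ≤ w' i) × (∀ i → w' i ≤ size i) ×
  (sumF (λ i → w' i ∸ w i) ≡ q ⊓ sumF (λ i → size i ∸ w i))

reset : ∀ {m} → Weights m → Fin m → Weights m
reset w j i with i ≟ j
... | yes _ = 0
... | no  _ = w i

-- A BoxBreaker strategy: given the history of positions right after each of
-- BoxMaker's moves so far (most recent first, nonempty in practice), choose
-- the box to reset.
BreakerStrategy : ℕ → Set
BreakerStrategy m = List (Weights m) → Fin m

board : ∀ {m} → BreakerStrategy m → List (Weights m) → Weights m
board σ []      = λ _ → 0
board σ (w ∷ h) = reset w (σ (w ∷ h))

-- Reach size q σ h : h (most recent first) is the history of positions right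
-- after BoxMaker's moves in some play of rBox(m,q) in which BoxBreaker follows σ
-- (BoxMaker playing arbitrarily, starting from the empty board).
data Reach {m} (size : Fin m → ℕ) (q : ℕ) (σ : BreakerStrategy m)
     : List (Weights m) → Set where
  start : Reach size q σ []
  step  : ∀ {h w'} → Reach size q σ h → MakerMove size q (board σ h) w' →
          Reach size q σ (w' ∷ h)

{-# OPTIONS --safe #-}
module Submission where

-- BoxBreaker always resets a heaviest box, and a position w is measured by the
-- potential Σᵢ e^{wᵢ/q}. If BoxMaker adds aᵢ to box i, with Σ aᵢ ≤ q, then
-- q (e^{(x+a)/q} − e^{x/q}) ≤ a e^{(x+a)/q} shows that the potential grows by at
-- most (Σ aᵢ / q) e^{w_max/q} ≤ e^{w_max/q}; resetting the heaviest box removes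
-- this term and adds e⁰ = 1. Hence after t rounds the potential is at most m + t,
-- so every box satisfies e^{wᵢ/q} ≤ m + k, i.e. e^{wᵢ} ≤ (m + k)^q, and BoxMaker's
-- next move adds at most q to a box.
--
-- To stay in ℕ, each exponential is replaced by the n-th partial sum of its series
-- scaled by n! qⁿ, and every inequality is proved for all n. Multiplicativity,
-- e^{(u+v)/q} ≤ e^{u/q} e^{v/q}, is then checked coefficientwise with the binomial
-- theorem.

open import Defs
open import Data.Nat hiding (_≟_)
open import Data.Nat.Properties hiding (_≟_)
open import Data.Nat.Combinatorics using (_C_; k>n⇒nCk≡0; nCk≡n!/k![n-k]!; k![n∸k]!∣n!)
open import Data.Nat.DivMod using (_/_; m/n*n≡m; *-/-assoc; n/n≡1)
open import Data.Nat.Divisibility using (m≤n⇒m!∣n!)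
open import Data.Nat.Tactic.RingSolver using (solve-∀)
open import Data.Fin using (Fin; zero; suc; toℕ; _≟_)
open import Data.Fin.Properties using (toℕ<n; punchInᵢ≢i)
open import Data.List using (List; []; _∷_; length)
open import Data.List.Relation.Unary.All using (All; []; _∷_)
open import Data.Product using (Σ; ∃; _×_; _,_; proj₁)
open import Data.Vec.Functional using (removeAt)
open import Function using (_∘_)
open import Relation.Binary.PropositionalEquality
open import Relation.Nullary using (yes; no; contradiction)
open import Algebra.Properties.Semiring.Sum +-*-semiring
import Algebra.Properties.CommutativeSemiring.Exp +-*-commutativeSemiring as Exp
import Algebra.Properties.CommutativeSemiring.Binomial +-*-commutativeSemiring as Binomial
open import Algebra.Definitions.RawSemiring +-*-rawSemiring using () renaming (_×_ to _×ᴬ_; _^_ to _^ᴬ_)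

sum-mono : ∀ {m} {f g : Fin m → ℕ} → (∀ i → f i ≤ g i) → sum f ≤ sum g
sum-mono {zero}  f≤g = z≤n
sum-mono {suc m} f≤g = +-mono-≤ (f≤g zero) (sum-mono (f≤g ∘ suc))

≤-sum : ∀ {m} (f : Fin (suc m) → ℕ) i → f i ≤ sum f
≤-sum f i = ≤-trans (m≤m+n (f i) _) (≤-reflexive (sym (sum-remove {i = i} f)))

sumTo : ℕ → (ℕ → ℕ) → ℕ
sumTo n f = ∑[ i < n ] f (toℕ i)

sumTo-cong : ∀ n {f g} → (∀ i → i < n → f i ≡ g i) → sumTo n f ≡ sumTo n g
sumTo-cong n f≡g = sum-cong-≗ (λ i → f≡g (toℕ i) (toℕ<n i))

sumTo-mono : ∀ n {f g} → (∀ i → i < n → f i ≤ g i) → sumTo n f ≤ sumTo n g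
sumTo-mono zero    f≤g = z≤n
sumTo-mono (suc n) f≤g = +-mono-≤ (f≤g 0 z<s) (sumTo-mono n (λ i i<n → f≤g (suc i) (s<s i<n)))

sumTo-last : ∀ n f → sumTo (suc n) f ≡ sumTo n f + f n
sumTo-last zero    f = +-comm (f 0) 0
sumTo-last (suc n) f = trans (cong (f 0 +_) (sumTo-last n (f ∘ suc))) (sym (+-assoc (f 0) _ _))

sumTo-extend : ∀ {m n f} → m ≤ n → (∀ i → m ≤ i → f i ≡ 0) → sumTo m f ≡ sumTo n f
sumTo-extend {n = zero}      z≤n       f≡0 = refl
sumTo-extend {n = suc n} {f} z≤n       f≡0 =
  trans (sumTo-extend {n = n} z≤n (λ i _ → f≡0 (suc i) z≤n))
        (cong (_+ sumTo n (f ∘ suc)) (sym (f≡0 0 z≤n)))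
sumTo-extend             {f = f} (s≤s m≤n) f≡0 =
  cong (f 0 +_) (sumTo-extend m≤n (λ i m≤i → f≡0 (suc i) (s≤s m≤i)))

sumTo-mono-shift : ∀ n i {g h} → (∀ j → j < i → g j ≡ 0) →
  (∀ l → i + l < n → g (i + l) ≤ h l) → sumTo n g ≤ sumTo n h
sumTo-mono-shift n       zero    g≡0 g≤h = sumTo-mono n g≤h
sumTo-mono-shift zero    (suc i) g≡0 g≤h = z≤n
sumTo-mono-shift (suc n) (suc i) {g} {h} g≡0 g≤h = begin
  g 0 + sumTo n (g ∘ suc) ≡⟨ cong (_+ sumTo n (g ∘ suc)) (g≡0 0 z<s) ⟩
  sumTo n (g ∘ suc)       ≤⟨ sumTo-mono-shift n i (λ j j<i → g≡0 (suc j) (s<s j<i))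
                                                   (λ l i+l<n → g≤h l (s<s i+l<n)) ⟩
  sumTo n h               ≤⟨ m≤m+n _ (h n) ⟩
  sumTo n h + h n         ≡⟨ sumTo-last n h ⟨
  sumTo (suc n) h         ∎
  where open ≤-Reasoning

-- The library's binomial theorem is stated with the generic semiring operations,
-- which agree with those of ℕ only propositionally.
×ᴬ≡* : ∀ m n → m ×ᴬ n ≡ m * n
×ᴬ≡* zero    n = refl
×ᴬ≡* (suc m) n = cong (n +_) (×ᴬ≡* m n)

^ᴬ≡^ : ∀ m n → m ^ᴬ n ≡ m ^ n
^ᴬ≡^ m zero    = refl
^ᴬ≡^ m (suc n) = cong (m *_) (^ᴬ≡^ m n)

^-distrib-* : ∀ m n o → (m * n) ^ o ≡ m ^ o * n ^ o
^-distrib-* m n o = begin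
  (m * n) ^ o      ≡⟨ ^ᴬ≡^ (m * n) o ⟨
  (m * n) ^ᴬ o     ≡⟨ Exp.^-distrib-* m n o ⟩
  m ^ᴬ o * n ^ᴬ o  ≡⟨ cong₂ _*_ (^ᴬ≡^ m o) (^ᴬ≡^ n o) ⟩
  m ^ o * n ^ o    ∎
  where open ≡-Reasoning

binomial-theorem : ∀ n u v → (u + v) ^ n ≡ sumTo (suc n) (λ i → (n C i) * (u ^ i * v ^ (n ∸ i)))
binomial-theorem n u v = begin
  (u + v) ^ n                       ≡⟨ ^ᴬ≡^ (u + v) n ⟨
  (u + v) ^ᴬ n                      ≡⟨ Binomial.theorem n u v ⟩
  Binomial.binomialExpansion u v n  ≡⟨ sum-cong-≗ {suc n} {Binomial.binomialTerm u v n} term-agrees ⟩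
  sumTo (suc n) (λ i → (n C i) * (u ^ i * v ^ (n ∸ i))) ∎
  where
    open ≡-Reasoning
    term-agrees : ∀ i → Binomial.binomialTerm u v n i ≡ (n C toℕ i) * (u ^ toℕ i * v ^ (n ∸ toℕ i))
    term-agrees i = trans (×ᴬ≡* (n C toℕ i) _)
      (cong₂ (λ a b → (n C toℕ i) * (a * b)) (^ᴬ≡^ u (toℕ i)) (^ᴬ≡^ v (n ∸ toℕ i)))

binomial-theorem-padded : ∀ {n N} u v → n < N → (u + v) ^ n ≡ sumTo N (λ i → (n C i) * (u ^ i * v ^ (n ∸ i)))
binomial-theorem-padded {n} u v n<N =
  trans (binomial-theorem n u v)
        (sumTo-extend {f = term} n<N (λ i n<i → cong (_* (u ^ i * v ^ (n ∸ i))) (k>n⇒nCk≡0 n<i)))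
  where
    term : ℕ → ℕ
    term i = (n C i) * (u ^ i * v ^ (n ∸ i))

infixl 8 _!÷_
_!÷_ : ℕ → ℕ → ℕ
n !÷ j = (n ! / j !) {{j !≢0}}

!÷*!≡! : ∀ {j n} → j ≤ n → n !÷ j * j ! ≡ n !
!÷*!≡! {j} j≤n = m/n*n≡m {{j !≢0}} (m≤n⇒m!∣n! j≤n)

suc-!÷ : ∀ {j n} → j ≤ n → suc n !÷ j ≡ suc n * n !÷ j
suc-!÷ {j} {n} j≤n = *-/-assoc (suc n) {{j !≢0}} (m≤n⇒m!∣n! j≤n)

n!÷n≡1 : ∀ n → n !÷ n ≡ 1
n!÷n≡1 n = n/n≡1 (n !) {{n !≢0}}

C*!*!≡! : ∀ i l → ((i + l) C i) * (i ! * l !) ≡ (i + l) !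
C*!*!≡! i l = begin
  ((i + l) C i) * (i ! * l !)
    ≡⟨ cong (λ d → ((i + l) C i) * (i ! * d !)) (m+n∸m≡n i l) ⟨
  ((i + l) C i) * (i ! * (i + l ∸ i) !)
    ≡⟨ cong (_* (i ! * (i + l ∸ i) !)) (nCk≡n!/k![n-k]! i≤i+l) ⟩
  (i + l) ! / (i ! * (i + l ∸ i) !) * (i ! * (i + l ∸ i) !)
    ≡⟨ m/n*n≡m (k![n∸k]!∣n! i≤i+l) ⟩
  (i + l) !
    ∎
  where
    open ≡-Reasoning
    i≤i+l = m≤m+n i l
    instance _ = i !* (i + l ∸ i) !≢0

!÷-product : ∀ {i l n} → i + l ≤ n → n ! * n !÷ (i + l) * ((i + l) C i) ≡ n !÷ i * n !÷ l
!÷-product {i} {l} {n} i+l≤n = *-cancelʳ-≡ _ _ (i ! * l !) {{i !* l !≢0}} (begin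
  n ! * n !÷ (i + l) * ((i + l) C i) * (i ! * l !)   ≡⟨ *-assoc (n ! * n !÷ (i + l)) _ _ ⟩
  n ! * n !÷ (i + l) * (((i + l) C i) * (i ! * l !)) ≡⟨ cong (n ! * n !÷ (i + l) *_) (C*!*!≡! i l) ⟩
  n ! * n !÷ (i + l) * (i + l) !                     ≡⟨ *-assoc (n !) _ _ ⟩
  n ! * (n !÷ (i + l) * (i + l) !)                   ≡⟨ cong (n ! *_) (!÷*!≡! i+l≤n) ⟩
  n ! * n !
    ≡⟨ cong₂ _*_ (!÷*!≡! (m+n≤o⇒m≤o i i+l≤n)) (!÷*!≡! (m+n≤o⇒n≤o i i+l≤n)) ⟨
  n !÷ i * i ! * (n !÷ l * l !)                      ≡⟨ interchange (n !÷ i) (i !) (n !÷ l) (l !) ⟩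
  n !÷ i * n !÷ l * (i ! * l !)                      ∎)
  where
    open ≡-Reasoning
    interchange : ∀ a b c d → a * b * (c * d) ≡ a * c * (b * d)
    interchange = solve-∀

-- expSum q x n = n! qⁿ Σ_{j ≤ n} (x/q)ʲ / j!, the scaled n-th partial sum of e^{x/q}.
expSum : ℕ → ℕ → ℕ → ℕ
expSum q x zero    = 1
expSum q x (suc n) = suc n * q * expSum q x n + x ^ suc n

scale : ℕ → ℕ → ℕ
scale q n = n ! * q ^ n

expSum-zero : ∀ q n → expSum q 0 n ≡ scale q n
expSum-zero q zero    = refl
expSum-zero q (suc n) = begin
  suc n * q * expSum q 0 n + 0 ^ suc n ≡⟨ cong (λ e → suc n * q * e + 0) (expSum-zero q n) ⟩
  suc n * q * (n ! * q ^ n) + 0        ≡⟨ regroup (suc n) q (n !) (q ^ n) ⟩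
  suc n * n ! * (q * q ^ n)            ∎
  where
    open ≡-Reasoning
    regroup : ∀ s q f p → s * q * (f * p) + 0 ≡ s * f * (q * p)
    regroup = solve-∀

expSum-mono : ∀ q n {x y} → x ≤ y → expSum q x n ≤ expSum q y n
expSum-mono q zero    x≤y = ≤-refl
expSum-mono q (suc n) x≤y = +-mono-≤ (*-monoʳ-≤ (suc n * q) (expSum-mono q n x≤y)) (^-monoˡ-≤ (suc n) x≤y)

^-increment-≤ : ∀ x a n → (x + a) ^ suc n ≤ x ^ suc n + suc n * a * (x + a) ^ n
^-increment-≤ x a zero    = ≤-reflexive (base x a)
  where
    base : ∀ x a → (x + a) * 1 ≡ x * 1 + 1 * a * 1
    base = solve-∀
^-increment-≤ x a (suc n) = begin
  (x + a) * (x + a) ^ suc n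
    ≤⟨ *-monoʳ-≤ (x + a) (^-increment-≤ x a n) ⟩
  (x + a) * (x ^ suc n + suc n * a * (x + a) ^ n)
    ≡⟨ expand x a (x ^ suc n) (suc n) ((x + a) ^ n) ⟩
  x * x ^ suc n + a * x ^ suc n + suc n * a * ((x + a) * (x + a) ^ n)
    ≤⟨ +-monoˡ-≤ _ (+-monoʳ-≤ (x * x ^ suc n) (*-monoʳ-≤ a (^-monoˡ-≤ (suc n) (m≤m+n x a)))) ⟩
  x * x ^ suc n + a * (x + a) ^ suc n + suc n * a * (x + a) ^ suc n
    ≡⟨ collect (x * x ^ suc n) a ((x + a) ^ suc n) (suc n) ⟩
  x * x ^ suc n + suc (suc n) * a * (x + a) ^ suc n
    ∎
  where
    open ≤-Reasoning
    expand : ∀ x a p s y → (x + a) * (p + s * a * y) ≡ x * p + a * p + s * a * ((x + a) * y)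
    expand = solve-∀
    collect : ∀ p a y s → p + a * y + s * a * y ≡ p + (1 + s) * a * y
    collect = solve-∀

expSum-suc-increment-≤ : ∀ q x a n →
  expSum q (x + a) (suc n) ≤ expSum q x (suc n) + a * (suc n * expSum q (x + a) n)
expSum-suc-increment-≤ q x a zero    = ≤-reflexive (base q x a)
  where
    base : ∀ q x a → 1 * q * 1 + (x + a) * 1 ≡ 1 * q * 1 + x * 1 + a * (1 * 1)
    base = solve-∀
expSum-suc-increment-≤ q x a (suc n) = begin
  s * q * expSum q (x + a) (suc n) + (x + a) ^ s
    ≤⟨ +-mono-≤ (*-monoʳ-≤ (s * q) (expSum-suc-increment-≤ q x a n)) (^-increment-≤ x a (suc n)) ⟩
  s * q * (expSum q x (suc n) + a * (suc n * expSum q (x + a) n)) + (x ^ s + s * a * (x + a) ^ suc n)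
    ≡⟨ regroup s q (expSum q x (suc n)) a (suc n) (expSum q (x + a) n) (x ^ s) ((x + a) ^ suc n) ⟩
  s * q * expSum q x (suc n) + x ^ s + a * (s * expSum q (x + a) (suc n))
    ∎
  where
    open ≤-Reasoning
    s = suc (suc n)
    regroup : ∀ s q e a t d y w →
      s * q * (e + a * (t * d)) + (y + s * a * w) ≡ s * q * e + y + a * (s * (t * q * d + w))
    regroup = solve-∀

expSum-increment-≤ : ∀ q x a n → q * expSum q (x + a) n ≤ q * expSum q x n + a * expSum q (x + a) n
expSum-increment-≤ q x a zero    = m≤m+n (q * 1) (a * 1)
expSum-increment-≤ q x a (suc n) = begin
  q * expSum q (x + a) (suc n)
    ≤⟨ *-monoʳ-≤ q (expSum-suc-increment-≤ q x a n) ⟩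
  q * (expSum q x (suc n) + a * (suc n * expSum q (x + a) n))
    ≡⟨ regroup q (expSum q x (suc n)) a (suc n) (expSum q (x + a) n) ⟩
  q * expSum q x (suc n) + a * (suc n * q * expSum q (x + a) n)
    ≤⟨ +-monoʳ-≤ (q * expSum q x (suc n)) (*-monoʳ-≤ a (m≤m+n _ ((x + a) ^ suc n))) ⟩
  q * expSum q x (suc n) + a * expSum q (x + a) (suc n)
    ∎
  where
    open ≤-Reasoning
    regroup : ∀ q e a s d → q * (e + a * (s * d)) ≡ q * e + a * (s * q * d)
    regroup = solve-∀

expPartial-mono : ∀ n {d d′} → d ≤ d′ → expPartial d n ≤ expPartial d′ n
expPartial-mono zero    d≤d′ = ≤-refl
expPartial-mono (suc n) d≤d′ = +-mono-≤ (*-monoʳ-≤ (suc n) (expPartial-mono n d≤d′)) (^-monoˡ-≤ (suc n) d≤d′)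

expSum-*ˡ : ∀ q u n → expSum q (q * u) n ≡ q ^ n * expPartial u n
expSum-*ˡ q u zero    = refl
expSum-*ˡ q u (suc n) = begin
  suc n * q * expSum q (q * u) n + (q * u) ^ suc n
    ≡⟨ cong₂ (λ e p → suc n * q * e + p) (expSum-*ˡ q u n) (^-distrib-* q u (suc n)) ⟩
  suc n * q * (q ^ n * expPartial u n) + q ^ suc n * u ^ suc n
    ≡⟨ regroup (suc n) q (q ^ n) (expPartial u n) (u * u ^ n) ⟩
  q ^ suc n * expPartial u (suc n)
    ∎
  where
    open ≡-Reasoning
    regroup : ∀ s q p e w → s * q * (p * e) + q * p * w ≡ q * p * (s * e + w)
    regroup = solve-∀

expTerm : ℕ → ℕ → ℕ → ℕ → ℕ
expTerm q x n j = n !÷ j * q ^ (n ∸ j) * x ^ j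

expSum-closed : ∀ q x n → expSum q x n ≡ sumTo (suc n) (expTerm q x n)
expSum-closed q x zero    = refl
expSum-closed q x (suc n) = begin
  suc n * q * expSum q x n + x ^ suc n
    ≡⟨ cong (λ e → suc n * q * e + x ^ suc n) (expSum-closed q x n) ⟩
  suc n * q * sumTo (suc n) (expTerm q x n) + x ^ suc n
    ≡⟨ cong (_+ x ^ suc n) (*-distribˡ-sum {suc n} (suc n * q) (expTerm q x n ∘ toℕ)) ⟩
  sumTo (suc n) (λ j → suc n * q * expTerm q x n j) + x ^ suc n
    ≡⟨ cong₂ _+_ (sumTo-cong (suc n) (λ j j<1+n → expTerm-suc (s≤s⁻¹ j<1+n))) (sym expTerm-diag) ⟩
  sumTo (suc n) (expTerm q x (suc n)) + expTerm q x (suc n) (suc n)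
    ≡⟨ sumTo-last (suc n) (expTerm q x (suc n)) ⟨
  sumTo (suc (suc n)) (expTerm q x (suc n))
    ∎
  where
    open ≡-Reasoning
    regroup : ∀ s q c p y → s * q * (c * p * y) ≡ s * c * (q * p) * y
    regroup = solve-∀
    expTerm-suc : ∀ {j} → j ≤ n → suc n * q * expTerm q x n j ≡ expTerm q x (suc n) j
    expTerm-suc {j} j≤n = begin
      suc n * q * (n !÷ j * q ^ (n ∸ j) * x ^ j)
        ≡⟨ regroup (suc n) q (n !÷ j) (q ^ (n ∸ j)) (x ^ j) ⟩
      suc n * n !÷ j * (q * q ^ (n ∸ j)) * x ^ j
        ≡⟨ cong₂ (λ c e → c * q ^ e * x ^ j) (suc-!÷ j≤n) (+-∸-assoc 1 j≤n) ⟨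
      suc n !÷ j * q ^ (suc n ∸ j) * x ^ j
        ∎
    expTerm-diag : expTerm q x (suc n) (suc n) ≡ x ^ suc n
    expTerm-diag = begin
      suc n !÷ suc n * q ^ (suc n ∸ suc n) * x ^ suc n
        ≡⟨ cong₂ (λ c e → c * q ^ e * x ^ suc n) (n!÷n≡1 (suc n)) (n∸n≡0 n) ⟩
      1 * 1 * x ^ suc n
        ≡⟨ *-identityˡ (x ^ suc n) ⟩
      x ^ suc n
        ∎

expTerm-*-expTerm : ∀ q u v {i l n} → i + l ≤ n →
  scale q n * (n !÷ (i + l) * q ^ (n ∸ (i + l))) * (((i + l) C i) * (u ^ i * v ^ (i + l ∸ i)))
    ≡ expTerm q u n i * expTerm q v n l
expTerm-*-expTerm q u v {i} {l} i+l≤n with m≤n⇒∃[o]m+o≡n i+l≤n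
... | r , refl = begin
  n ! * q ^ n * (n !÷ (i + l) * q ^ (n ∸ (i + l))) * (((i + l) C i) * (u ^ i * v ^ (i + l ∸ i)))
    ≡⟨ cong₂ (λ e f → n ! * q ^ n * (n !÷ (i + l) * q ^ e) * (((i + l) C i) * (u ^ i * v ^ f)))
             (m+n∸m≡n (i + l) r) (m+n∸m≡n i l) ⟩
  n ! * q ^ n * (n !÷ (i + l) * q ^ r) * (((i + l) C i) * (u ^ i * v ^ l))
    ≡⟨ regroup₁ (n !) (q ^ n) (n !÷ (i + l)) (q ^ r) ((i + l) C i) (u ^ i) (v ^ l) ⟩
  n ! * n !÷ (i + l) * ((i + l) C i) * (q ^ n * q ^ r) * u ^ i * v ^ l
    ≡⟨ cong₂ (λ c p → c * p * u ^ i * v ^ l) (!÷-product {i} {l} i+l≤n) powers ⟩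
  n !÷ i * n !÷ l * (q ^ (l + r) * q ^ (i + r)) * u ^ i * v ^ l
    ≡⟨ regroup₂ (n !÷ i) (n !÷ l) (q ^ (l + r)) (q ^ (i + r)) (u ^ i) (v ^ l) ⟩
  n !÷ i * q ^ (l + r) * u ^ i * (n !÷ l * q ^ (i + r) * v ^ l)
    ≡⟨ cong₂ (λ e f → n !÷ i * q ^ e * u ^ i * (n !÷ l * q ^ f * v ^ l)) n∸i n∸l ⟨
  expTerm q u n i * expTerm q v n l
    ∎
  where
    open ≡-Reasoning
    n = i + l + r
    n∸i : n ∸ i ≡ l + r
    n∸i = trans (cong (_∸ i) (+-assoc i l r)) (m+n∸m≡n i (l + r))
    n∸l : n ∸ l ≡ i + r
    n∸l = trans (cong (_∸ l) (swap i l r)) (m+n∸m≡n l (i + r))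
      where
        swap : ∀ i l r → i + l + r ≡ l + (i + r)
        swap = solve-∀
    powers : q ^ n * q ^ r ≡ q ^ (l + r) * q ^ (i + r)
    powers = begin
      q ^ n * q ^ r             ≡⟨ ^-distribˡ-+-* q n r ⟨
      q ^ (n + r)               ≡⟨ cong (q ^_) (exponents i l r) ⟩
      q ^ (l + r + (i + r))     ≡⟨ ^-distribˡ-+-* q (l + r) (i + r) ⟩
      q ^ (l + r) * q ^ (i + r) ∎
      where
        exponents : ∀ i l r → i + l + r + r ≡ l + r + (i + r)
        exponents = solve-∀
    regroup₁ : ∀ f p c s b x y → f * p * (c * s) * (b * (x * y)) ≡ f * c * b * (p * s) * x * y
    regroup₁ = solve-∀
    regroup₂ : ∀ a b s t x y → a * b * (s * t) * x * y ≡ a * s * x * (b * t * y)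
    regroup₂ = solve-∀

-- After expanding (u + v)ʲ, the term G i (i + l) on the left is the product of the
-- i-th and l-th terms on the right, and G i j vanishes for j < i.
expSum-+-≤ : ∀ q u v n → scale q n * expSum q (u + v) n ≤ expSum q u n * expSum q v n
expSum-+-≤ q u v n = begin
  scale q n * expSum q (u + v) n
    ≡⟨ cong (scale q n *_) (expSum-closed q (u + v) n) ⟩
  scale q n * sumTo N (expTerm q (u + v) n)
    ≡⟨ *-distribˡ-sum {N} (scale q n) (expTerm q (u + v) n ∘ toℕ) ⟩
  sumTo N (λ j → scale q n * expTerm q (u + v) n j)
    ≡⟨ sumTo-cong N (λ j j<N → expand j<N) ⟩
  sumTo N (λ j → sumTo N (λ i → G i j))
    ≡⟨ ∑-comm {N} {N} (λ j i → G (toℕ i) (toℕ j)) ⟩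
  sumTo N (λ i → sumTo N (λ j → G i j))
    ≤⟨ sumTo-mono N (λ i _ → sumTo-mono-shift N i (G-below i) (G-shifted i)) ⟩
  sumTo N (λ i → sumTo N (λ l → expTerm q u n i * expTerm q v n l))
    ≡⟨ sumTo-cong N (λ i _ → *-distribˡ-sum {N} (expTerm q u n i) (expTerm q v n ∘ toℕ)) ⟨
  sumTo N (λ i → expTerm q u n i * sumTo N (expTerm q v n))
    ≡⟨ *-distribʳ-sum {N} (sumTo N (expTerm q v n)) (expTerm q u n ∘ toℕ) ⟨
  sumTo N (expTerm q u n) * sumTo N (expTerm q v n)
    ≡⟨ cong₂ _*_ (expSum-closed q u n) (expSum-closed q v n) ⟨
  expSum q u n * expSum q v n
    ∎
  where
    open ≤-Reasoning
    N = suc n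
    coefficient : ℕ → ℕ
    coefficient j = scale q n * (n !÷ j * q ^ (n ∸ j))
    G : ℕ → ℕ → ℕ
    G i j = coefficient j * ((j C i) * (u ^ i * v ^ (j ∸ i)))
    expand : ∀ {j} → j < N → scale q n * expTerm q (u + v) n j ≡ sumTo N (λ i → G i j)
    expand {j} j<N = begin-equality
      scale q n * (n !÷ j * q ^ (n ∸ j) * (u + v) ^ j)
        ≡⟨ *-assoc (scale q n) _ _ ⟨
      coefficient j * (u + v) ^ j
        ≡⟨ cong (coefficient j *_) (binomial-theorem-padded u v j<N) ⟩
      coefficient j * sumTo N (λ i → (j C i) * (u ^ i * v ^ (j ∸ i)))
        ≡⟨ *-distribˡ-sum {N} (coefficient j) (λ i → (j C toℕ i) * (u ^ toℕ i * v ^ (j ∸ toℕ i))) ⟩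
      sumTo N (λ i → G i j)
        ∎
    G-below : ∀ i j → j < i → G i j ≡ 0
    G-below i j j<i =
      trans (cong (λ c → coefficient j * (c * (u ^ i * v ^ (j ∸ i)))) (k>n⇒nCk≡0 j<i)) (*-zeroʳ (coefficient j))
    G-shifted : ∀ i l → i + l < N → G i (i + l) ≤ expTerm q u n i * expTerm q v n l
    G-shifted i l i+l<N = ≤-reflexive (expTerm-*-expTerm q u v {i} {l} (s≤s⁻¹ i+l<N))

expSum-*-≤ : ∀ q u n k → scale q n ^ k * expSum q (k * u) n ≤ expSum q u n ^ k * scale q n
expSum-*-≤ q u n zero    = ≤-reflexive (cong (1 *_) (expSum-zero q n))
expSum-*-≤ q u n (suc k) = begin
  Z * Z ^ k * expSum q (u + k * u) n           ≡⟨ regroup₁ Z (Z ^ k) (expSum q (u + k * u) n) ⟩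
  Z ^ k * (Z * expSum q (u + k * u) n)         ≤⟨ *-monoʳ-≤ (Z ^ k) (expSum-+-≤ q u (k * u) n) ⟩
  Z ^ k * (expSum q u n * expSum q (k * u) n)  ≡⟨ regroup₂ (Z ^ k) (expSum q u n) (expSum q (k * u) n) ⟩
  expSum q u n * (Z ^ k * expSum q (k * u) n)  ≤⟨ *-monoʳ-≤ (expSum q u n) (expSum-*-≤ q u n k) ⟩
  expSum q u n * (expSum q u n ^ k * Z)        ≡⟨ *-assoc (expSum q u n) _ _ ⟨
  expSum q u n * expSum q u n ^ k * Z          ∎
  where
    open ≤-Reasoning
    Z = scale q n
    regroup₁ : ∀ z y e → z * y * e ≡ y * (z * e)
    regroup₁ = solve-∀
    regroup₂ : ∀ y e f → y * (e * f) ≡ e * (y * f)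
    regroup₂ = solve-∀

-- e^{u/q} ≤ N implies e^u ≤ N^q.
expLe-from-expSum : ∀ q u N .{{_ : NonZero q}} → (∀ n → expSum q u n ≤ N * scale q n) → ExpLe u (N ^ q)
expLe-from-expSum q u N expSum≤ n = *-cancelˡ-≤ (q ^ n) {{m^n≢0 q n}} (*-cancelˡ-≤ (Z ^ q) {{Z^q≢0}} (begin
  Z ^ q * (q ^ n * expPartial u n)    ≡⟨ cong (Z ^ q *_) (expSum-*ˡ q u n) ⟨
  Z ^ q * expSum q (q * u) n          ≤⟨ expSum-*-≤ q u n q ⟩
  expSum q u n ^ q * Z                ≤⟨ *-monoˡ-≤ Z (^-monoˡ-≤ q (expSum≤ n)) ⟩
  (N * Z) ^ q * Z                     ≡⟨ cong (_* Z) (^-distrib-* N Z q) ⟩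
  N ^ q * Z ^ q * Z                   ≡⟨ regroup (N ^ q) (Z ^ q) (n !) (q ^ n) ⟩
  Z ^ q * (q ^ n * (N ^ q * n !))     ∎))
  where
    open ≤-Reasoning
    Z = scale q n
    Z^q≢0 : NonZero (Z ^ q)
    Z^q≢0 = m^n≢0 Z q {{m*n≢0 (n !) (q ^ n) {{n !≢0}} {{m^n≢0 q n}}}}
    regroup : ∀ a b f p → a * b * (f * p) ≡ b * (p * (a * f))
    regroup = solve-∀

sumF≡sum : ∀ {m} (f : Fin m → ℕ) → sumF f ≡ sum f
sumF≡sum {zero}  f = refl
sumF≡sum {suc m} f = cong (f zero +_) (sumF≡sum (f ∘ suc))

reset-self : ∀ {m} (w : Weights m) j → reset w j j ≡ 0
reset-self w j with j ≟ j
... | yes _   = refl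
... | no j≢j = contradiction refl j≢j

reset-other : ∀ {m} (w : Weights m) {i j} → i ≢ j → reset w j i ≡ w i
reset-other w {i} {j} i≢j with i ≟ j
... | yes i≡j = contradiction i≡j i≢j
... | no _    = refl

heaviest : ∀ {m} (w : Weights (suc m)) → ∃ λ j → ∀ i → w i ≤ w j
heaviest {zero}  w = zero , λ { zero → ≤-refl }
heaviest {suc m} w with heaviest (w ∘ suc)
... | j , w∘suc≤ with w (suc j) ≤? w zero
...   | yes wj≤w0 = zero  , λ { zero → ≤-refl ; (suc i) → ≤-trans (w∘suc≤ i) wj≤w0 }
...   | no  wj≰w0 = suc j , λ { zero → <⇒≤ (≰⇒> wj≰w0) ; (suc i) → w∘suc≤ i }

resetHeaviest : ∀ {m} → BreakerStrategy (suc m)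
resetHeaviest []      = zero
resetHeaviest (w ∷ _) = proj₁ (heaviest w)

makerMove-claimed-≤ : ∀ {m size q} {b w : Weights m} → MakerMove size q b w → sum (λ i → w i ∸ b i) ≤ q
makerMove-claimed-≤ {q = q} {b} {w} (_ , _ , claimed) =
  ≤-trans (≤-reflexive (trans (sym (sumF≡sum (λ i → w i ∸ b i))) claimed)) (m⊓n≤m q _)

makerMove-≤ : ∀ {m size q} {b w : Weights (suc m)} → MakerMove size q b w → ∀ i → w i ≤ b i + q
makerMove-≤ {q = q} {b} {w} move@(b≤w , _ , _) i = begin
  w i               ≡⟨ m+[n∸m]≡n (b≤w i) ⟨
  b i + (w i ∸ b i) ≤⟨ +-monoʳ-≤ (b i) (≤-trans (≤-sum (λ i → w i ∸ b i) i) (makerMove-claimed-≤ move)) ⟩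
  b i + q           ∎
  where open ≤-Reasoning

-- potential q n w = n! qⁿ Σᵢ e^{wᵢ/q}, truncated at order n.
potential : ∀ {m} → ℕ → ℕ → Weights m → ℕ
potential q n w = sum (λ i → expSum q (w i) n)

potential-reset : ∀ {m} q n (w : Weights (suc m)) j →
  potential q n (reset w j) + expSum q (w j) n ≡ potential q n w + scale q n
potential-reset q n w j = begin
  potential q n (reset w j) + E (w j)
    ≡⟨ cong (_+ E (w j)) (sum-remove {i = j} (E ∘ reset w j)) ⟩
  E (reset w j j) + sum (removeAt (E ∘ reset w j) j) + E (w j)
    ≡⟨ cong₂ (λ a b → a + b + E (w j)) (trans (cong E (reset-self w j)) (expSum-zero q n))
             (sum-cong-≗ (λ k → cong E (reset-other w (punchInᵢ≢i j k)))) ⟩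
  scale q n + sum (removeAt (E ∘ w) j) + E (w j)
    ≡⟨ swap (scale q n) (sum (removeAt (E ∘ w) j)) (E (w j)) ⟩
  E (w j) + sum (removeAt (E ∘ w) j) + scale q n
    ≡⟨ cong (_+ scale q n) (sum-remove {i = j} (E ∘ w)) ⟨
  potential q n w + scale q n
    ∎
  where
    open ≡-Reasoning
    E : ℕ → ℕ
    E x = expSum q x n
    swap : ∀ a b c → a + b + c ≡ c + b + a
    swap = solve-∀

potential-makerMove-≤ : ∀ {m size} q n .{{_ : NonZero q}} {b w : Weights m} j →
  MakerMove size q b w → (∀ i → w i ≤ w j) → potential q n w ≤ potential q n b + expSum q (w j) n
potential-makerMove-≤ q n {b} {w} j move@(b≤w , _ , _) w≤wj = *-cancelˡ-≤ q (begin
  q * potential q n w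
    ≡⟨ *-distribˡ-sum q (E ∘ w) ⟩
  sum (λ i → q * E (w i))
    ≤⟨ sum-mono increment ⟩
  sum (λ i → q * E (b i) + claimed i * E (w i))
    ≡⟨ ∑-distrib-+ (λ i → q * E (b i)) (λ i → claimed i * E (w i)) ⟩
  sum (λ i → q * E (b i)) + sum (λ i → claimed i * E (w i))
    ≤⟨ +-mono-≤ (≤-reflexive (sym (*-distribˡ-sum q (E ∘ b))))
                (sum-mono (λ i → *-monoʳ-≤ (claimed i) (expSum-mono q n (w≤wj i)))) ⟩
  q * potential q n b + sum (λ i → claimed i * E (w j))
    ≡⟨ cong (q * potential q n b +_) (*-distribʳ-sum (E (w j)) claimed) ⟨
  q * potential q n b + sum claimed * E (w j)
    ≤⟨ +-monoʳ-≤ (q * potential q n b) (*-monoˡ-≤ (E (w j)) (makerMove-claimed-≤ move)) ⟩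
  q * potential q n b + q * E (w j)
    ≡⟨ *-distribˡ-+ q _ _ ⟨
  q * (potential q n b + E (w j))
    ∎)
  where
    open ≤-Reasoning
    E : ℕ → ℕ
    E x = expSum q x n
    claimed : Fin _ → ℕ
    claimed i = w i ∸ b i
    increment : ∀ i → q * E (w i) ≤ q * E (b i) + claimed i * E (w i)
    increment i = subst (λ y → q * E y ≤ q * E (b i) + claimed i * E y) (m+[n∸m]≡n (b≤w i))
                        (expSum-increment-≤ q (b i) (claimed i) n)

potential-round-≤ : ∀ {m size} q n .{{_ : NonZero q}} {b w : Weights (suc m)} → MakerMove size q b w →
  potential q n (reset w (proj₁ (heaviest w))) ≤ potential q n b + scale q n
potential-round-≤ q n {b} {w} move with heaviest w
... | j , w≤wj = +-cancelʳ-≤ (expSum q (w j) n) _ _ (begin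
  potential q n (reset w j) + expSum q (w j) n   ≡⟨ potential-reset q n w j ⟩
  potential q n w + scale q n                    ≤⟨ +-monoˡ-≤ (scale q n) (potential-makerMove-≤ q n j move w≤wj) ⟩
  potential q n b + expSum q (w j) n + scale q n ≡⟨ swap (potential q n b) (expSum q (w j) n) (scale q n) ⟩
  potential q n b + scale q n + expSum q (w j) n ∎)
  where
    open ≤-Reasoning
    swap : ∀ a b c → a + b + c ≡ a + c + b
    swap = solve-∀

potential-board-≤ : ∀ {m} {size : Fin (suc m) → ℕ} {q h} .{{_ : NonZero q}} → Reach size q resetHeaviest h →
  ∀ n → potential q n (board resetHeaviest h) ≤ (suc m + length h) * scale q n
potential-board-≤ {m} {q = q} start n = ≤-reflexive (begin
  sum {suc m} (λ _ → expSum q 0 n) ≡⟨ sum-replicate (suc m) ⟩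
  suc m ×ᴬ expSum q 0 n            ≡⟨ ×ᴬ≡* (suc m) _ ⟩
  suc m * expSum q 0 n             ≡⟨ cong₂ _*_ (sym (+-identityʳ (suc m))) (expSum-zero q n) ⟩
  (suc m + 0) * scale q n          ∎)
  where open ≡-Reasoning
potential-board-≤ {m} {q = q} {h = w ∷ h} (step reach move) n = begin
  potential q n (board resetHeaviest (w ∷ h))                ≤⟨ potential-round-≤ q n move ⟩
  potential q n (board resetHeaviest h) + scale q n          ≤⟨ +-monoˡ-≤ (scale q n) (potential-board-≤ reach n) ⟩
  (suc m + length h) * scale q n + scale q n                 ≡⟨ regroup (suc m) (length h) (scale q n) ⟩
  (suc m + suc (length h)) * scale q n                       ∎
  where
    open ≤-Reasoning
    regroup : ∀ a t z → (a + t) * z + z ≡ (a + (1 + t)) * z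
    regroup = solve-∀

weightBound-from-expSum : ∀ q N .{{_ : NonZero q}} {x y} → y ≤ x + q →
  (∀ n → expSum q x n ≤ N * scale q n) → WeightBound q N y
weightBound-from-expSum q N {x} {y} y≤x+q expSum≤ n =
  ≤-trans (expPartial-mono n (m≤n+o⇒m∸n≤o y q (≤-trans y≤x+q (≤-reflexive (+-comm x q)))))
          (expLe-from-expSum q x N expSum≤ n)

board-expSum-≤ : ∀ {m} {size : Fin (suc m) → ℕ} {q h k} .{{_ : NonZero q}} →
  Reach size q resetHeaviest h → length h ≤ k →
  ∀ i n → expSum q (board resetHeaviest h i) n ≤ (suc m + k) * scale q n
board-expSum-≤ {m} {q = q} {h = h} {k = k} reach |h|≤k i n = begin
  expSum q (board resetHeaviest h i) n             ≤⟨ ≤-sum (λ i → expSum q (board resetHeaviest h i) n) i ⟩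
  potential q n (board resetHeaviest h)            ≤⟨ potential-board-≤ reach n ⟩
  (suc m + length h) * scale q n                   ≤⟨ *-monoˡ-≤ (scale q n) (+-monoʳ-≤ (suc m) |h|≤k) ⟩
  (suc m + k) * scale q n                          ∎
  where open ≤-Reasoning

theorem2p6 : (m q : ℕ) → 1 ≤ m → 1 ≤ q → (size : Fin m → ℕ) →
    (k : ℕ) → 1 ≤ k →
    Σ (BreakerStrategy m) (λ σ →
      (h : List (Weights m)) → Reach size q σ h → length h ≤ k →
        All (λ w → (i : Fin m) → WeightBound q (m + k) (w i)) h ×
        ((i : Fin m) → WeightBound q (m + k) (board σ h i)))
theorem2p6 (suc m) q _ 1≤q size k _ =
  resetHeaviest , λ h reach |h|≤k → maker-bounded reach |h|≤k , breaker-bounded reach |h|≤k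
  where
    instance
      q≢0 : NonZero q
      q≢0 = >-nonZero 1≤q
    breaker-bounded : ∀ {h} → Reach size q resetHeaviest h → length h ≤ k →
      (i : Fin (suc m)) → WeightBound q (suc m + k) (board resetHeaviest h i)
    breaker-bounded reach |h|≤k i =
      weightBound-from-expSum q _ (m≤m+n _ q) (board-expSum-≤ reach |h|≤k i)
    maker-bounded : ∀ {h} → Reach size q resetHeaviest h → length h ≤ k →
      All (λ w → (i : Fin (suc m)) → WeightBound q (suc m + k) (w i)) h
    maker-bounded start               _     = []
    maker-bounded (step reach move) |h|<k =
      (λ i → weightBound-from-expSum q _ (makerMove-≤ move i) (board-expSum-≤ reach (<⇒≤ |h|<k) i))
      ∷ maker-bounded reach (<⇒≤ |h|<k)
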